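{- Let $p$ be a prime and let $3\le k\le p$. Then for every $n$ and every subset $S\subseteq\mathbb{F}_p^n$ of size at least $p^{1+(1-\frac1k)n}$, the set $(S-S)\setminus\{0\}$ contains a non-trivial $k$-term arithmetic progression, i.e. there are $a,d\in\mathbb{F}_p^n$ with $d\neq 0$ such that $a,a+d,\dots,a+(k-1)d$ all lie in $(S-S)\setminus\{0\}$.
   Context: $S-S=\{x-y: x,y\in S\}$. -}

module Defs where

open import Data.Nat using (ℕ; NonZero; _+_; _*_; _∸_)
open import Data.Nat.DivMod using (_mod_)
open import Data.Fin using (Fin; toℕ)
open import Data.Vec using (Vec; zipWith; map; replicate)
open import Data.List using (List)
open import Data.List.Membership.Propositional using (_∈_)
open import Data.Product using (Σ; ∃; _×_; _,_)
open import Relation.Binary.PropositionalEquality using (_≡_; _≢_)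

module _ (p : ℕ) .{{_ : NonZero p}} where

  _+ₚ_ : Fin p → Fin p → Fin p
  x +ₚ y = (toℕ x + toℕ y) mod p

  _-ₚ_ : Fin p → Fin p → Fin p
  x -ₚ y = (toℕ x + (p ∸ toℕ y)) mod p

  _·ₚ_ : ℕ → Fin p → Fin p
  j ·ₚ x = (j * toℕ x) mod p

  zeroᵥ : ∀ {n} → Vec (Fin p) n
  zeroᵥ = replicate _ (0 mod p)

  _+ᵥ_ : ∀ {n} → Vec (Fin p) n → Vec (Fin p) n → Vec (Fin p) n
  _+ᵥ_ = zipWith _+ₚ_

  _-ᵥ_ : ∀ {n} → Vec (Fin p) n → Vec (Fin p) n → Vec (Fin p) n
  _-ᵥ_ = zipWith _-ₚ_

  _·ᵥ_ : ∀ {n} → ℕ → Vec (Fin p) n → Vec (Fin p) n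
  j ·ᵥ v = map (j ·ₚ_) v

  InDiffSet : ∀ {n} → List (Vec (Fin p) n) → Vec (Fin p) n → Set
  InDiffSet S x = Σ _ λ y → Σ _ λ z → y ∈ S × z ∈ S × x ≡ (y -ᵥ z)

  InDiffSetNonzero : ∀ {n} → List (Vec (Fin p) n) → Vec (Fin p) n → Set
  InDiffSetNonzero S x = InDiffSet S x × x ≢ zeroᵥ

  DiffSetHasAP : (k : ℕ) → ∀ {n} → List (Vec (Fin p) n) → Set
  DiffSetHasAP k {n} S =
    Σ (Vec (Fin p) n) λ a → Σ (Vec (Fin p) n) λ d →
      d ≢ zeroᵥ × ((j : Fin k) → InDiffSetNonzero S (a +ᵥ (toℕ j ·ᵥ d)))

-- Write k = m + 2 and map each k-tuple s ∈ Sᵏ to its key, the list of deviations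
-- s_j − s₀ − j (s₁ − s₀) for 2 ≤ j < k, an element of (𝔽_pⁿ)ᵐ. If s and t have the same key, the
-- differences s_j − t_j form a progression a + j d lying in S − S. It is degenerate (d = 0, or some
-- term vanishes) only if t can be rebuilt from s and one entry of t in one of k + 1 ways, so at most
-- (k + 1)|S| members of a fiber are bad for a given s. Pigeonhole yields a fiber with more members
-- than that as soon as p^{nm} (k + 1)|S| < |S|ᵏ, and this follows from |S|ᵏ ≥ p^{k + (k−1)n}
-- because k + 1 < p^{k−1}.
module Submission where

open import Defs
open import Data.Nat using (ℕ; NonZero; zero; suc; z≤n; s≤s)
open import Data.Fin using (Fin; toℕ)
open import Data.Vec using (Vec; lookup; tabulate)
open import Data.List using (List; []; _∷_; length; filter; cartesianProductWith)
open import Data.List.Membership.Propositional using (_∈_; _∉_)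
open import Data.List.Relation.Unary.Any using (here; there)
open import Data.List.Relation.Unary.Unique.Propositional using (Unique)
open import Data.Product using (∃; _×_; _,_; proj₁)
open import Relation.Nullary using (yes; no; contradiction)
open import Relation.Binary.Definitions using (DecidableEquality)
open import Relation.Binary.PropositionalEquality
  using (_≡_; _≢_; refl; sym; trans; cong; cong₂; subst; subst₂; module ≡-Reasoning)

module Counting where

  open import Data.Nat using (_+_; _*_; _^_; _≤_; _<_; s≤s⁻¹; _<?_)
  open import Data.Nat.Properties using (≤-trans; <-≤-trans; ≤-reflexive; +-monoˡ-≤; +-cancelˡ-<; ≮⇒≥; +-suc)
  open import Data.Fin using (zero; suc)
  open import Data.Vec using ([]; _∷_)
  open import Data.Vec.Properties using (∷-injective)
  open import Data.List using ([_]; map)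
  open import Data.List.Properties using (length-++; length-map; length-removeAt′)
  open import Data.List.Membership.Propositional using (_─_)
  open import Data.List.Membership.Propositional.Properties
    using (∈-filter⁻; ∈-cartesianProductWith⁺; ∈-cartesianProductWith⁻)
  open import Data.List.Relation.Unary.Any using (index)
  import Data.List.Relation.Unary.All as All
  open import Data.List.Relation.Unary.Unique.Propositional using ([]; _∷_)
  open import Data.List.Relation.Unary.Unique.Propositional.Properties using (cartesianProductWith⁺)
  open import Data.List.Relation.Binary.Sublist.Propositional.Properties using (filter-⊆; filter⁺; length-mono-≤)
  open import Data.Empty using (⊥-elim)
  open import Relation.Unary.Properties using (∁?)

  length-cartesianProductWith : ∀ {A B C : Set} (f : A → B → C) xs ys →
                                length (cartesianProductWith f xs ys) ≡ length xs * length ys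
  length-cartesianProductWith f [] ys = refl
  length-cartesianProductWith f (x ∷ xs) ys =
    trans (length-++ (map (f x) ys)) (cong₂ _+_ (length-map (f x) ys) (length-cartesianProductWith f xs ys))

  module _ {A : Set} where

    tuples : (k : ℕ) → List A → List (Vec A k)
    tuples zero xs = [ [] ]
    tuples (suc k) xs = cartesianProductWith _∷_ xs (tuples k xs)

    length-tuples : ∀ k xs → length (tuples k xs) ≡ length xs ^ k
    length-tuples zero xs = refl
    length-tuples (suc k) xs =
      trans (length-cartesianProductWith _∷_ xs (tuples k xs)) (cong (length xs *_) (length-tuples k xs))

    ∈-tuples⁺ : ∀ {k xs} {v : Vec A k} → (∀ i → lookup v i ∈ xs) → v ∈ tuples k xs
    ∈-tuples⁺ {v = []} _ = here refl
    ∈-tuples⁺ {v = x ∷ v} h = ∈-cartesianProductWith⁺ _∷_ (h zero) (∈-tuples⁺ (λ i → h (suc i)))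

    ∈-tuples⁻ : ∀ {k xs} {v : Vec A k} → v ∈ tuples k xs → ∀ i → lookup v i ∈ xs
    ∈-tuples⁻ {suc k} {xs} v∈ i with ∈-cartesianProductWith⁻ _∷_ xs (tuples k xs) v∈
    ∈-tuples⁻ v∈ zero    | _ , _ , x∈ , _ , refl = x∈
    ∈-tuples⁻ v∈ (suc i) | _ , _ , _ , w∈ , refl = ∈-tuples⁻ w∈ i

    tuples⁺ : ∀ {k xs} → Unique xs → Unique (tuples k xs)
    tuples⁺ {zero} _ = All.[] ∷ []
    tuples⁺ {suc k} uniq = cartesianProductWith⁺ _∷_ ∷-injective uniq (tuples⁺ uniq)

    ∈-─⁺ : ∀ {x y : A} {ys} (y∈ys : y ∈ ys) → x ∈ ys → x ≢ y → x ∈ ys ─ y∈ys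
    ∈-─⁺ (here refl) (here refl) x≢y = ⊥-elim (x≢y refl)
    ∈-─⁺ (here refl) (there x∈ys) _ = x∈ys
    ∈-─⁺ (there _) (here refl) _ = here refl
    ∈-─⁺ (there y∈ys) (there x∈ys) x≢y = there (∈-─⁺ y∈ys x∈ys x≢y)

    module _ (_≟_ : DecidableEquality A) where

      open import Data.List.Membership.DecPropositional _≟_ using (_∈?_)

      unique-longer⇒∃∉ : ∀ xs ys → Unique xs → length ys < length xs → ∃ λ x → x ∈ xs × x ∉ ys
      unique-longer⇒∃∉ (x ∷ xs) ys (x∉xs ∷ uniq) ys<x∷xs with x ∈? ys
      ... | no x∉ys = x , here refl , x∉ys
      ... | yes x∈ys
        with z , z∈xs , z∉ys─x ← unique-longer⇒∃∉ xs (ys ─ x∈ys) uniq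
               (subst (_≤ length xs) (length-removeAt′ ys (index x∈ys)) (s≤s⁻¹ ys<x∷xs))
        = z , there z∈xs , λ z∈ys → z∉ys─x (∈-─⁺ x∈ys z∈ys (λ { refl → All.lookup x∉xs z∈xs refl }))

  module _ {A B : Set} (_≟_ : DecidableEquality B) (f : A → B) where

    fiber : B → List A → List A
    fiber y = filter (λ x → f x ≟ y)

    private
      outside : B → List A → List A
      outside y = filter (∁? (λ x → f x ≟ y))

      length-fiber+outside : ∀ y xs → length xs ≡ length (fiber y xs) + length (outside y xs)
      length-fiber+outside y [] = refl
      length-fiber+outside y (x ∷ xs) with f x ≟ y
      ... | yes _ = cong suc (length-fiber+outside y xs)
      ... | no _ = trans (cong suc (length-fiber+outside y xs)) (sym (+-suc _ _))

      outside-covered : ∀ {y ys xs} → (∀ {x} → x ∈ xs → f x ∈ y ∷ ys) → ∀ {x} → x ∈ outside y xs → f x ∈ ys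
      outside-covered {y} cover x∈ with x∈xs , fx≢y ← ∈-filter⁻ (∁? (λ x → f x ≟ y)) x∈ with cover x∈xs
      ... | here fx≡y = ⊥-elim (fx≢y fx≡y)
      ... | there fx∈ys = fx∈ys

      outside-large : ∀ M y ys xs → length (y ∷ ys) * M < length xs → length (fiber y xs) ≤ M →
                      length ys * M < length (outside y xs)
      outside-large M y ys xs large fiber≤M = +-cancelˡ-< M _ _
        (<-≤-trans large (≤-trans (≤-reflexive (length-fiber+outside y xs)) (+-monoˡ-≤ _ fiber≤M)))

      fiber-of-outside : ∀ y z xs → length (fiber z (outside y xs)) ≤ length (fiber z xs)
      fiber-of-outside y z xs = length-mono-≤ (filter⁺ _ _ (λ { refl fx≡z → fx≡z }) (filter-⊆ _ xs))

    ∃-large-fiber : ∀ M ys xs → (∀ {x} → x ∈ xs → f x ∈ ys) → length ys * M < length xs →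
                    ∃ λ y → M < length (fiber y xs)
    ∃-large-fiber M [] (x ∷ _) cover _ with () ← cover (here refl)
    ∃-large-fiber M (y ∷ ys) xs cover large with M <? length (fiber y xs)
    ... | yes M<fiber = y , M<fiber
    ... | no M≮fiber
      with z , M<fiber ← ∃-large-fiber M ys (outside y xs) (outside-covered cover)
                                           (outside-large M y ys xs large (≮⇒≥ M≮fiber))
      = z , <-≤-trans M<fiber (fiber-of-outside y z xs)

module PowerBounds where

  open import Data.Nat using (_+_; _*_; _^_; _≤_; _<_)
  open import Data.Nat.Properties
    using ( ^-*-assoc; ^-distribˡ-+-*; ^-monoˡ-≤; ^-monoʳ-≤; ^-monoˡ-<; *-monoʳ-<; *-mono-≤; *-identityʳ; *-comm
          ; m≤m*n; m≤n*m; m≤n+m; m^n≢0; m^n>0; ≤-trans; <-≤-trans; ≤-reflexive; ≰⇒>; <⇒≱; module ≤-Reasoning)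
  open import Data.Nat.Tactic.RingSolver using (solve-∀)

  ^-distribʳ-* : ∀ a b c → (a * b) ^ c ≡ a ^ c * b ^ c
  ^-distribʳ-* a b zero = refl
  ^-distribʳ-* a b (suc c) = trans (cong (a * b *_) (^-distribʳ-* a b c)) (interchange a b (a ^ c) (b ^ c))
    where
    interchange : ∀ a b x y → a * b * (x * y) ≡ a * x * (b * y)
    interchange = solve-∀

  ^-cancelʳ-< : ∀ {a b} k → a ^ k < b ^ k → a < b
  ^-cancelʳ-< k aᵏ<bᵏ = ≰⇒> (λ b≤a → <⇒≱ aᵏ<bᵏ (^-monoˡ-≤ k b≤a))

  1+n<n*n : ∀ n → 2 ≤ n → suc n < n * n
  1+n<n*n (suc (suc n)) (s≤s (s≤s z≤n)) = s≤s (s≤s (≤-trans (m≤n*m (suc (suc n)) (suc n)) (m≤n+m _ n)))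

  bound-power-split : ∀ p m n → (p ^ ((2 + m) + (1 + m) * n)) ^ (1 + m) ≡
                                ((p ^ n) ^ m) ^ (2 + m) * ((p ^ (1 + m)) ^ (2 + m) * p ^ n)
  bound-power-split p m n = begin
    (p ^ (k + q * n)) ^ q                        ≡⟨ ^-*-assoc p (k + q * n) q ⟩
    p ^ ((k + q * n) * q)                        ≡⟨ cong (p ^_) (exponents m n) ⟩
    p ^ (n * (m * k) + (q * k + n))              ≡⟨ ^-distribˡ-+-* p (n * (m * k)) _ ⟩
    p ^ (n * (m * k)) * p ^ (q * k + n)          ≡⟨ cong (p ^ (n * (m * k)) *_) (^-distribˡ-+-* p (q * k) n) ⟩
    p ^ (n * (m * k)) * (p ^ (q * k) * p ^ n)    ≡⟨ cong₂ (λ x y → x * (y * p ^ n)) pⁿᵐᵏ (sym (^-*-assoc p q k)) ⟩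
    ((p ^ n) ^ m) ^ k * ((p ^ q) ^ k * p ^ n)    ∎
    where
    open ≡-Reasoning
    k = 2 + m
    q = 1 + m
    exponents : ∀ m n → (2 + m + (1 + m) * n) * (1 + m) ≡ n * (m * (2 + m)) + ((1 + m) * (2 + m) + n)
    exponents = solve-∀
    pⁿᵐᵏ : p ^ (n * (m * k)) ≡ ((p ^ n) ^ m) ^ k
    pⁿᵐᵏ = sym (trans (^-*-assoc (p ^ n) m k) (^-*-assoc p n (m * k)))

  size-bound : ∀ {p N} m n → 1 ≤ m → 2 + m ≤ p → p ^ ((2 + m) + (1 + m) * n) ≤ N ^ (2 + m) →
               (p ^ n) ^ m * ((3 + m) * N) < N ^ (2 + m)
  size-bound {zero} m n _ () _
  size-bound {p@(suc _)} {zero} m n _ _ bound = contradiction bound (<⇒≱ (m^n>0 p (2 + m + (1 + m) * n)))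
  size-bound {p@(suc _)} {N@(suc _)} m n 1≤m k≤p bound = begin-strict
    (p ^ n) ^ m * ((3 + m) * N)    ≡⟨ regroup ((p ^ n) ^ m) (3 + m) N ⟩
    N * ((p ^ n) ^ m * suc k)      <⟨ *-monoʳ-< N root ⟩
    N * N ^ q                      ∎
    where
    open ≤-Reasoning
    k = 2 + m
    q = 1 + m
    regroup : ∀ a b c → a * (b * c) ≡ c * (a * b)
    regroup = solve-∀
    instance
      pⁿ≢0 : NonZero (p ^ n)
      pⁿ≢0 = m^n≢0 p n
      pⁿᵐᵏ≢0 : NonZero (((p ^ n) ^ m) ^ k)
      pⁿᵐᵏ≢0 = m^n≢0 _ k {{m^n≢0 _ m}}
    1+k<p^q : suc k < p ^ q
    1+k<p^q = begin-strict
      suc k    <⟨ 1+n<n*n k (s≤s (s≤s z≤n)) ⟩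
      k * k    ≤⟨ *-mono-≤ k≤p (≤-trans k≤p (≤-reflexive (sym (*-identityʳ p)))) ⟩
      p ^ 2    ≤⟨ ^-monoʳ-≤ p (s≤s 1≤m) ⟩
      p ^ q    ∎
    root : (p ^ n) ^ m * suc k < N ^ q
    root = ^-cancelʳ-< k (begin-strict
      ((p ^ n) ^ m * suc k) ^ k                  ≡⟨ ^-distribʳ-* ((p ^ n) ^ m) (suc k) k ⟩
      ((p ^ n) ^ m) ^ k * suc k ^ k              <⟨ *-monoʳ-< _ (<-≤-trans (^-monoˡ-< k 1+k<p^q) (m≤m*n _ (p ^ n))) ⟩
      ((p ^ n) ^ m) ^ k * ((p ^ q) ^ k * p ^ n)  ≡⟨ bound-power-split p m n ⟨
      (p ^ (k + q * n)) ^ q                      ≤⟨ ^-monoˡ-≤ q bound ⟩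
      (N ^ k) ^ q                                ≡⟨ ^-*-assoc N k q ⟩
      N ^ (k * q)                                ≡⟨ cong (N ^_) (*-comm k q) ⟩
      N ^ (q * k)                                ≡⟨ ^-*-assoc N q k ⟨
      (N ^ q) ^ k                                ∎)

module Modular where

  open import Data.Nat as ℕ using (_<_)
  import Data.Nat.Properties as ℕₚ
  open import Data.Nat.DivMod using (_mod_)
  open import Data.Nat.Divisibility using (∣⇒≤) renaming (_∣_ to _∣ℕ_)
  open import Data.Integer using (ℤ; +_; _+_; _-_; _*_; -_; ∣_∣)
  open import Data.Integer.DivMod using (_%ℕ_; _/ℕ_; n%ℕd<d; a≡a%ℕn+[a/ℕn]*n)
  open import Data.Integer.Properties
    using ( +-inverseʳ; +-minus-telescope; +-identityˡ; pos-+; pos-*; ⊖-≥; m-n≡m⊖n; ∣m⊝n∣≤m⊔n; ∣i∣≡0⇒i≡0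
          ; i-j≡0⇒i≡j; +-injective)
  open import Data.Integer.Divisibility.Signed using (_∣_; divides; ∣m∣n⇒∣m+n; ∣m⇒∣-m; ∣n⇒∣m*n; ∣⇒∣ᵤ)
  open import Data.Integer.Tactic.RingSolver using (solve-∀)
  open import Data.Fin using (zero; suc; fromℕ<; inject₁)
  open import Data.Fin.Properties using (toℕ-fromℕ<; toℕ<n; toℕ-injective; toℕ-inject₁)
  open import Data.Vec.Properties
    using (tabulate∘lookup; tabulate-cong; lookup∘tabulate; lookup-zipWith; lookup-map; lookup-replicate)
  open import Data.List using (map; allFin)
  open import Data.List.Properties using (length-map; length-tabulate)
  open import Data.List.Membership.Propositional.Properties using (∈-cartesianProductWith⁺; ∈-map⁺; ∈-allFin)
  open import Relation.Binary.Core using (_⇒_)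
  open import Relation.Binary.Bundles using (Setoid)
  open import Relation.Binary.Definitions using (Reflexive; Symmetric; Transitive)
  import Relation.Binary.Reasoning.Setoid as SetoidReasoning
  open import Level using (0ℓ)
  open Counting using (tuples; ∈-tuples⁻; length-cartesianProductWith)

  m∣n∧n<m⇒n≡0 : ∀ {m n} → m ∣ℕ n → n < m → n ≡ 0
  m∣n∧n<m⇒n≡0 {n = zero} _ _ = refl
  m∣n∧n<m⇒n≡0 {n = suc _} m∣n n<m = contradiction (∣⇒≤ m∣n) (ℕₚ.<⇒≱ n<m)

  ≡-tabulate : ∀ {A : Set} {n} {v : Vec A n} {f : Fin n → A} → (∀ i → lookup v i ≡ f i) → v ≡ tabulate f
  ≡-tabulate {v = v} h = trans (sym (tabulate∘lookup v)) (tabulate-cong h)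

  module Congruence (p : ℕ) where

    infix 4 _≈_
    record _≈_ (a b : ℤ) : Set where
      constructor congruent
      field p∣a-b : + p ∣ a - b

    ≈-reflexive : _≡_ ⇒ _≈_
    ≈-reflexive {a} refl = congruent (divides (+ 0) (+-inverseʳ a))

    ≈-refl : Reflexive _≈_
    ≈-refl = ≈-reflexive refl

    ≈-sym : Symmetric _≈_
    ≈-sym {a} {b} (congruent p∣a-b) = congruent (subst (+ p ∣_) (negate-minus a b) (∣m⇒∣-m p∣a-b))
      where
      negate-minus : ∀ a b → - (a - b) ≡ b - a
      negate-minus = solve-∀

    ≈-trans : Transitive _≈_
    ≈-trans {a} {b} {c} (congruent p∣a-b) (congruent p∣b-c) =
      congruent (subst (+ p ∣_) (+-minus-telescope a b c) (∣m∣n⇒∣m+n p∣a-b p∣b-c))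

    ≈-by-difference : ∀ {a b x y} → a - b ≡ x - y → x ≈ y → a ≈ b
    ≈-by-difference eq (congruent p∣x-y) = congruent (subst (+ p ∣_) (sym eq) p∣x-y)

    ≈-setoid : Setoid 0ℓ 0ℓ
    ≈-setoid = record { _≈_ = _≈_ ; isEquivalence = record { refl = ≈-refl ; sym = ≈-sym ; trans = ≈-trans } }

    module ≈-Reasoning = SetoidReasoning ≈-setoid

    +-cong : ∀ {a b c d} → a ≈ b → c ≈ d → a + c ≈ b + d
    +-cong {a} {b} {c} {d} (congruent p∣a-b) (congruent p∣c-d) =
      congruent (subst (+ p ∣_) (interchange a b c d) (∣m∣n⇒∣m+n p∣a-b p∣c-d))
      where
      interchange : ∀ a b c d → (a - b) + (c - d) ≡ (a + c) - (b + d)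
      interchange = solve-∀

    +-congˡ : ∀ a {b c} → b ≈ c → a + b ≈ a + c
    +-congˡ a = +-cong (≈-refl {a})

    +-congʳ : ∀ c {a b} → a ≈ b → a + c ≈ b + c
    +-congʳ c a≈b = +-cong a≈b (≈-refl {c})

    -‿cong : ∀ {a b} → a ≈ b → - a ≈ - b
    -‿cong {a} {b} (congruent p∣a-b) = congruent (subst (+ p ∣_) (negate-minus a b) (∣m⇒∣-m p∣a-b))
      where
      negate-minus : ∀ a b → - (a - b) ≡ - a - - b
      negate-minus = solve-∀

    *-congˡ : ∀ c {a b} → a ≈ b → c * a ≈ c * b
    *-congˡ c {a} {b} (congruent p∣a-b) = congruent (subst (+ p ∣_) (distrib c a b) (∣n⇒∣m*n c p∣a-b))
      where
      distrib : ∀ c a b → c * (a - b) ≡ c * a - c * b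
      distrib = solve-∀

    p≈0 : + p ≈ + 0
    p≈0 = congruent (divides (+ 1) (minus-zero (+ p)))
      where
      minus-zero : ∀ x → x - + 0 ≡ + 1 * x
      minus-zero = solve-∀

  module Residues (p : ℕ) .{{_ : NonZero p}} where

    open Congruence p

    ⟦_⟧ : Fin p → ℤ
    ⟦ x ⟧ = + toℕ x

    reduce : ℤ → Fin p
    reduce z = fromℕ< (n%ℕd<d z p)

    ⟦reduce⟧ : ∀ z → ⟦ reduce z ⟧ ≈ z
    ⟦reduce⟧ z = ≈-sym (congruent (divides q (begin
      z - ⟦ reduce z ⟧                     ≡⟨ cong (λ r → z - + r) (toℕ-fromℕ< _) ⟩
      z - + r                              ≡⟨ cong (_- + r) (a≡a%ℕn+[a/ℕn]*n z p) ⟩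
      (+ r + q * + p) - + r                ≡⟨ add-sub-cancel (+ r) (q * + p) ⟩
      q * + p                              ∎)))
      where
      open ≡-Reasoning
      r = z %ℕ p
      q = z /ℕ p
      add-sub-cancel : ∀ r x → (r + x) - r ≡ x
      add-sub-cancel = solve-∀

    -- `m mod p` is definitionally `reduce (+ m)`, since `(+ m) %ℕ p` computes to `m % p`.
    ⟦mod⟧ : ∀ m → ⟦ m mod p ⟧ ≈ + m
    ⟦mod⟧ m = ⟦reduce⟧ (+ m)

    ⟦+ₚ⟧ : ∀ x y → ⟦ _+ₚ_ p x y ⟧ ≈ ⟦ x ⟧ + ⟦ y ⟧
    ⟦+ₚ⟧ x y = ≈-trans (⟦mod⟧ _) (≈-reflexive (pos-+ (toℕ x) (toℕ y)))

    ⟦·ₚ⟧ : ∀ j x → ⟦ _·ₚ_ p j x ⟧ ≈ + j * ⟦ x ⟧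
    ⟦·ₚ⟧ j x = ≈-trans (⟦mod⟧ _) (≈-reflexive (pos-* j (toℕ x)))

    ⟦-ₚ⟧ : ∀ x y → ⟦ _-ₚ_ p x y ⟧ ≈ ⟦ x ⟧ - ⟦ y ⟧
    ⟦-ₚ⟧ x y = begin
      ⟦ _-ₚ_ p x y ⟧                   ≈⟨ ⟦mod⟧ _ ⟩
      + (toℕ x ℕ.+ (p ℕ.∸ toℕ y))      ≡⟨ pos-+ (toℕ x) _ ⟩
      ⟦ x ⟧ + + (p ℕ.∸ toℕ y)          ≡⟨ cong (λ z → ⟦ x ⟧ + z) p-y≡p∸y ⟨
      ⟦ x ⟧ + (+ p - ⟦ y ⟧)            ≈⟨ +-congˡ ⟦ x ⟧ (+-congʳ (- ⟦ y ⟧) p≈0) ⟩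
      ⟦ x ⟧ + (+ 0 - ⟦ y ⟧)            ≡⟨ cong (λ z → ⟦ x ⟧ + z) (+-identityˡ (- ⟦ y ⟧)) ⟩
      ⟦ x ⟧ - ⟦ y ⟧                    ∎
      where
      open ≈-Reasoning
      p-y≡p∸y : + p - ⟦ y ⟧ ≡ + (p ℕ.∸ toℕ y)
      p-y≡p∸y = trans (m-n≡m⊖n p (toℕ y)) (⊖-≥ (ℕₚ.<⇒≤ (toℕ<n y)))

    ⟦⟧-injective : ∀ {x y} → ⟦ x ⟧ ≈ ⟦ y ⟧ → x ≡ y
    ⟦⟧-injective {x} {y} (congruent p∣x-y) =
      toℕ-injective (+-injective (i-j≡0⇒i≡j _ _ (∣i∣≡0⇒i≡0 (m∣n∧n<m⇒n≡0 (∣⇒∣ᵤ p∣x-y) ∣x-y∣<p))))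
      where
      ∣x-y∣≤x⊔y : ∣ ⟦ x ⟧ - ⟦ y ⟧ ∣ ℕ.≤ toℕ x ℕ.⊔ toℕ y
      ∣x-y∣≤x⊔y = subst (λ z → ∣ z ∣ ℕ.≤ toℕ x ℕ.⊔ toℕ y) (sym (m-n≡m⊖n (toℕ x) (toℕ y)))
                        (∣m⊝n∣≤m⊔n (toℕ x) (toℕ y))
      ∣x-y∣<p : ∣ ⟦ x ⟧ - ⟦ y ⟧ ∣ < p
      ∣x-y∣<p = ℕₚ.≤-<-trans ∣x-y∣≤x⊔y (ℕₚ.⊔-lub (toℕ<n x) (toℕ<n y))

  module Coordinates (p : ℕ) .{{_ : NonZero p}} {n : ℕ} where

    open Congruence p
    open Residues p

    _⊕_ _⊖_ : Vec (Fin p) n → Vec (Fin p) n → Vec (Fin p) n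
    _⊕_ = _+ᵥ_ p
    _⊖_ = _-ᵥ_ p

    _⊙_ : ℕ → Vec (Fin p) n → Vec (Fin p) n
    _⊙_ = _·ᵥ_ p

    𝟎 : Vec (Fin p) n
    𝟎 = zeroᵥ p

    coord : Vec (Fin p) n → Fin n → ℤ
    coord v c = ⟦ lookup v c ⟧

    reduceᵥ : (Fin n → ℤ) → Vec (Fin p) n
    reduceᵥ f = tabulate (λ c → reduce (f c))

    coord-reduceᵥ : ∀ f c → coord (reduceᵥ f) c ≈ f c
    coord-reduceᵥ f c = ≈-trans (≈-reflexive (cong ⟦_⟧ (lookup∘tabulate _ c))) (⟦reduce⟧ (f c))

    ≡-reduceᵥ : ∀ {v f} → (∀ c → coord v c ≈ f c) → v ≡ reduceᵥ f
    ≡-reduceᵥ {f = f} h = ≡-tabulate (λ c → ⟦⟧-injective (≈-trans (h c) (≈-sym (⟦reduce⟧ (f c)))))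

    coord-injective : ∀ {u v} → (∀ c → coord u c ≈ coord v c) → u ≡ v
    coord-injective h = trans (≡-reduceᵥ h) (sym (≡-reduceᵥ (λ _ → ≈-refl)))

    coord-⊕ : ∀ u v c → coord (u ⊕ v) c ≈ coord u c + coord v c
    coord-⊕ u v c = ≈-trans (≈-reflexive (cong ⟦_⟧ (lookup-zipWith _ c u v))) (⟦+ₚ⟧ (lookup u c) (lookup v c))

    coord-⊖ : ∀ u v c → coord (u ⊖ v) c ≈ coord u c - coord v c
    coord-⊖ u v c = ≈-trans (≈-reflexive (cong ⟦_⟧ (lookup-zipWith _ c u v))) (⟦-ₚ⟧ (lookup u c) (lookup v c))

    coord-⊙ : ∀ j v c → coord (j ⊙ v) c ≈ + j * coord v c
    coord-⊙ j v c = ≈-trans (≈-reflexive (cong ⟦_⟧ (lookup-map c _ v))) (⟦·ₚ⟧ j (lookup v c))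

    coord-≡𝟎 : ∀ {v} → v ≡ 𝟎 → ∀ c → coord v c ≈ + 0
    coord-≡𝟎 refl c = ≈-trans (≈-reflexive (cong ⟦_⟧ (lookup-replicate c _))) (⟦mod⟧ 0)

  module Progressions (p m : ℕ) where

    open Congruence p

    k : ℕ
    k = suc (suc m)

    0F 1F : Fin k
    0F = zero
    1F = suc zero

    deviation : (Fin k → ℤ) → Fin k → ℤ
    deviation u i = u i - (u 0F + + toℕ i * (u 1F - u 0F))

    IsProgression : (Fin k → ℤ) → Set
    IsProgression u = ∀ i → u i ≈ u 0F + + toℕ i * (u 1F - u 0F)

    equal-deviations⇒progression : ∀ {u v} → (∀ j → deviation u (suc (suc j)) ≈ deviation v (suc (suc j))) →
                                   IsProgression (λ i → u i - v i)
    equal-deviations⇒progression {u} {v} h i =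
      ≈-by-difference (deviation-linear (u i) (v i) (u 0F) (v 0F) (u 1F) (v 1F) (+ toℕ i)) (agree i)
      where
      deviation-linear : ∀ ui vi u0 v0 u1 v1 i →
        (ui - vi) - ((u0 - v0) + i * ((u1 - v1) - (u0 - v0))) ≡
        (ui - (u0 + i * (u1 - u0))) - (vi - (v0 + i * (v1 - v0)))
      deviation-linear = solve-∀
      deviation-at-0 : ∀ u0 u1 → u0 - (u0 + + 0 * (u1 - u0)) ≡ + 0
      deviation-at-0 = solve-∀
      deviation-at-1 : ∀ u0 u1 → u1 - (u0 + + 1 * (u1 - u0)) ≡ + 0
      deviation-at-1 = solve-∀
      agree : ∀ i → deviation u i ≈ deviation v i
      agree zero = ≈-reflexive (trans (deviation-at-0 (u 0F) (u 1F)) (sym (deviation-at-0 (v 0F) (v 1F))))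
      agree (suc zero) = ≈-reflexive (trans (deviation-at-1 (u 0F) (u 1F)) (sym (deviation-at-1 (v 0F) (v 1F))))
      agree (suc (suc j)) = h j

    Pattern : Set
    Pattern = Fin k × (Fin k → ℤ)

    DeterminedBy : (Fin k → ℤ) → Pattern → Set
    DeterminedBy u (a , w) = ∀ i → u i ≈ w i * u a

    constant : Pattern
    constant = 0F , λ _ → + 1

    -- A progression vanishing at j is u i = (i − j) d, and d = ± u (j ∓ 1) is read off a neighbour of j.
    vanishingAt : Fin k → Pattern
    vanishingAt zero = 1F , λ i → + toℕ i
    vanishingAt (suc j) = inject₁ j , λ i → + toℕ (suc j) - + toℕ i

    patterns : List Pattern
    patterns = constant ∷ map vanishingAt (allFin k)

    constant-progression : ∀ {u} → IsProgression u → u 1F - u 0F ≈ + 0 → DeterminedBy u constant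
    constant-progression {u} prog d≈0 i = begin
      u i                                     ≈⟨ prog i ⟩
      u 0F + + toℕ i * (u 1F - u 0F)          ≈⟨ +-congˡ (u 0F) (*-congˡ (+ toℕ i) d≈0) ⟩
      u 0F + + toℕ i * + 0                    ≡⟨ drop-zero (u 0F) (+ toℕ i) ⟩
      + 1 * u 0F                              ∎
      where
      open ≈-Reasoning
      drop-zero : ∀ a i → a + i * + 0 ≡ + 1 * a
      drop-zero = solve-∀

    vanishing-progression : ∀ {u} → IsProgression u → ∀ j → u j ≈ + 0 → DeterminedBy u (vanishingAt j)
    vanishing-progression {u} prog zero u0≈0 i = begin
      u i                                     ≈⟨ prog i ⟩
      u 0F + + toℕ i * (u 1F - u 0F)          ≈⟨ +-cong u0≈0 (*-congˡ (+ toℕ i) (+-congˡ (u 1F) (-‿cong u0≈0))) ⟩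
      + 0 + + toℕ i * (u 1F - + 0)            ≡⟨ drop-zeros (+ toℕ i) (u 1F) ⟩
      + toℕ i * u 1F                          ∎
      where
      open ≈-Reasoning
      drop-zeros : ∀ i u1 → + 0 + i * (u1 - + 0) ≡ i * u1
      drop-zeros = solve-∀
    vanishing-progression {u} prog (suc j) uj+1≈0 i = begin
      u i                                     ≈⟨ prog i ⟩
      a + I * d                               ≡⟨ interpolate a d I J ⟨
      (+ 1 + J - I) * (a + J * d) + (I - J) * (a + (+ 1 + J) * d)
                                              ≈⟨ +-cong (*-congˡ (+ 1 + J - I) at-j) (*-congˡ (I - J) at-j+1) ⟩
      (+ 1 + J - I) * u (inject₁ j) + (I - J) * + 0
                                              ≡⟨ drop-zero (+ 1 + J - I) (u (inject₁ j)) (I - J) ⟩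
      (+ 1 + J - I) * u (inject₁ j)           ∎
      where
      open ≈-Reasoning
      a = u 0F
      d = u 1F - u 0F
      I = + toℕ i
      J = + toℕ j
      interpolate : ∀ a d i j → (+ 1 + j - i) * (a + j * d) + (i - j) * (a + (+ 1 + j) * d) ≡ a + i * d
      interpolate = solve-∀
      drop-zero : ∀ c x e → c * x + e * + 0 ≡ c * x
      drop-zero = solve-∀
      at-j : a + J * d ≈ u (inject₁ j)
      at-j = ≈-sym (subst (λ r → u (inject₁ j) ≈ a + + r * d) (toℕ-inject₁ j) (prog (inject₁ j)))
      at-j+1 : a + (+ 1 + J) * d ≈ + 0
      at-j+1 = ≈-trans (≈-sym (subst (λ r → u (suc j) ≈ a + r * d) (pos-+ 1 (toℕ j)) (prog (suc j)))) uj+1≈0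

  module TupleKeys (p : ℕ) .{{_ : NonZero p}} (n m : ℕ) (S : List (Vec (Fin p) n)) where

    open Congruence p
    open Coordinates p {n}
    open Progressions p m

    Tuple : Set
    Tuple = Vec (Vec (Fin p) n) k

    column : Tuple → Fin n → Fin k → ℤ
    column s c i = coord (lookup s i) c

    gap : Tuple → Tuple → Fin n → Fin k → ℤ
    gap s t c i = column s c i - column t c i

    coord-gap : ∀ s t j c → coord (lookup s j ⊖ lookup t j) c ≈ gap s t c j
    coord-gap s t j c = coord-⊖ (lookup s j) (lookup t j) c

    deviations : Tuple → Fin m → Fin n → ℤ
    deviations s j c = deviation (column s c) (suc (suc j))

    key : Tuple → Vec (Vec (Fin p) n) m
    key s = tabulate (λ j → reduceᵥ (deviations s j))

    coord-key : ∀ s j c → coord (lookup (key s) j) c ≈ deviations s j c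
    coord-key s j c =
      ≈-trans (≈-reflexive (cong (λ v → coord v c) (lookup∘tabulate (λ j → reduceᵥ (deviations s j)) j)))
              (coord-reduceᵥ (deviations s j) c)

    equal-keys⇒progression : ∀ s t → key s ≡ key t → ∀ c → IsProgression (gap s t c)
    equal-keys⇒progression s t eq c = equal-deviations⇒progression {column s c} {column t c} λ j → begin
      deviations s j c                ≈⟨ coord-key s j c ⟨
      coord (lookup (key s) j) c      ≡⟨ cong (λ v → coord (lookup v j) c) eq ⟩
      coord (lookup (key t) j) c      ≈⟨ coord-key t j c ⟩
      deviations t j c                ∎
      where open ≈-Reasoning

    first-term common-difference : Tuple → Tuple → Vec (Fin p) n
    first-term s t = lookup s 0F ⊖ lookup t 0F
    common-difference s t = (lookup s 1F ⊖ lookup t 1F) ⊖ first-term s t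

    coord-common-difference : ∀ s t c → coord (common-difference s t) c ≈ gap s t c 1F - gap s t c 0F
    coord-common-difference s t c =
      ≈-trans (coord-⊖ (lookup s 1F ⊖ lookup t 1F) (first-term s t) c)
              (+-cong (coord-gap s t 1F c) (-‿cong (coord-gap s t 0F c)))

    differences-progress : ∀ s t → key s ≡ key t →
                           ∀ j → first-term s t ⊕ (toℕ j ⊙ common-difference s t) ≡ lookup s j ⊖ lookup t j
    differences-progress s t eq j = coord-injective λ c → begin
      coord (a ⊕ (toℕ j ⊙ d)) c                                ≈⟨ coord-⊕ a (toℕ j ⊙ d) c ⟩
      coord a c + coord (toℕ j ⊙ d) c                          ≈⟨ +-congˡ (coord a c) (coord-⊙ (toℕ j) d c) ⟩
      coord a c + + toℕ j * coord d c
        ≈⟨ +-cong (coord-gap s t 0F c) (*-congˡ (+ toℕ j) (coord-common-difference s t c)) ⟩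
      gap s t c 0F + + toℕ j * (gap s t c 1F - gap s t c 0F)   ≈⟨ equal-keys⇒progression s t eq c j ⟨
      gap s t c j                                              ≈⟨ coord-gap s t j c ⟨
      coord (lookup s j ⊖ lookup t j) c                        ∎
      where
      open ≈-Reasoning
      a = first-term s t
      d = common-difference s t

    rebuild : Tuple → Pattern → Vec (Fin p) n → Tuple
    rebuild s (a , w) x = tabulate λ i → reduceᵥ λ c → column s c i - w i * (column s c a - coord x c)

    rebuild-recovers : ∀ s t π → (∀ c → DeterminedBy (gap s t c) π) → t ≡ rebuild s π (lookup t (proj₁ π))
    rebuild-recovers s t (a , w) determined = ≡-tabulate λ i → ≡-reduceᵥ λ c → begin
      column t c i                          ≡⟨ sub-sub (column s c i) (column t c i) ⟨
      column s c i - gap s t c i            ≈⟨ +-congˡ (column s c i) (-‿cong (determined c i)) ⟩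
      column s c i - w i * gap s t c a      ∎
      where
      open ≈-Reasoning
      sub-sub : ∀ x y → x - (x - y) ≡ y
      sub-sub = solve-∀

    exceptions : Tuple → List Tuple
    exceptions s = cartesianProductWith (rebuild s) patterns S

    length-exceptions : ∀ s → length (exceptions s) ≡ suc k ℕ.* length S
    length-exceptions s = trans (length-cartesianProductWith (rebuild s) patterns S)
      (cong (λ l → suc l ℕ.* length S)
            (trans (length-map vanishingAt (allFin k)) (length-tabulate {n = k} (λ i → i))))

    determined⇒exception : ∀ s {t π} → π ∈ patterns → t ∈ tuples k S → (∀ c → DeterminedBy (gap s t c) π) →
                           t ∈ exceptions s
    determined⇒exception s {t} {π} π∈ t∈ determined =
      subst (_∈ exceptions s) (sym (rebuild-recovers s t π determined))
            (∈-cartesianProductWith⁺ (rebuild s) π∈ (∈-tuples⁻ {xs = S} t∈ (proj₁ π)))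

    progression-in-difference-set : ∀ {s t} → s ∈ tuples k S → t ∈ tuples k S → key s ≡ key t →
                                    t ∉ exceptions s → DiffSetHasAP p k S
    progression-in-difference-set {s} {t} s∈ t∈ eq t∉ =
      first-term s t , common-difference s t , difference≢𝟎 , λ j → term∈S-S j , term≢𝟎 j
      where
      term∈S-S : ∀ j → InDiffSet p S (first-term s t ⊕ (toℕ j ⊙ common-difference s t))
      term∈S-S j =
        lookup s j , lookup t j , ∈-tuples⁻ {xs = S} s∈ j , ∈-tuples⁻ {xs = S} t∈ j , differences-progress s t eq j
      difference≢𝟎 : common-difference s t ≢ 𝟎
      difference≢𝟎 d≡𝟎 = t∉ (determined⇒exception s (here refl) t∈ λ c →
        constant-progression (equal-keys⇒progression s t eq c)
          (≈-trans (≈-sym (coord-common-difference s t c)) (coord-≡𝟎 d≡𝟎 c)))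
      term≢𝟎 : ∀ j → first-term s t ⊕ (toℕ j ⊙ common-difference s t) ≢ 𝟎
      term≢𝟎 j term≡𝟎 = t∉ (determined⇒exception s (there (∈-map⁺ vanishingAt (∈-allFin j))) t∈ λ c →
        vanishing-progression (equal-keys⇒progression s t eq c) j
          (≈-trans (≈-sym (coord-gap s t j c))
                   (coord-≡𝟎 (trans (sym (differences-progress s t eq j)) term≡𝟎) c)))

open Counting
open PowerBounds
open Modular using (module TupleKeys)
open import Data.Nat using (_+_; _*_; _∸_; _^_; _≤_; _<_)
open import Data.Nat.Properties using (≤-<-trans)
open import Data.Nat.Primality using (Prime; prime⇒nonZero)
open import Data.Fin using (_≟_)
open import Data.Vec.Properties using (≡-dec)
open import Data.List using (allFin)
open import Data.List.Properties using (length-tabulate)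
open import Data.List.Membership.Propositional.Properties using (∈-filter⁻; ∈-allFin)
open import Data.List.Relation.Unary.Unique.Propositional.Properties using (filter⁺)

many-tuples⇒DiffSetHasAP : ∀ p .{{_ : NonZero p}} n m (S : List (Vec (Fin p) n)) → Unique S →
                           (p ^ n) ^ m * ((3 + m) * length S) < length S ^ (2 + m) → DiffSetHasAP p (2 + m) S
many-tuples⇒DiffSetHasAP p n m S unique-S large =
  let y , large-fiber = ∃-large-fiber _≟ₖ_ key ((3 + m) * length S) (tuples m points) (tuples (2 + m) S)
                          (λ {s} _ → key-listed s) (subst₂ (λ a b → a * ((3 + m) * length S) < b)
                                                             (sym length-keys) (sym (length-tuples (2 + m) S)) large)
      F = fiber _≟ₖ_ key y (tuples (2 + m) S)
      unique-F = filter⁺ (λ x → key x ≟ₖ y) (tuples⁺ unique-S)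
      s , s∈F , _ = unique-longer⇒∃∉ _≟ₜ_ F [] unique-F (≤-<-trans z≤n large-fiber)
      t , t∈F , t∉exceptions = unique-longer⇒∃∉ _≟ₜ_ F (exceptions s) unique-F
                                 (subst (_< length F) (sym (length-exceptions s)) large-fiber)
      s∈ , key-s≡y = ∈-filter⁻ (λ x → key x ≟ₖ y) s∈F
      t∈ , key-t≡y = ∈-filter⁻ (λ x → key x ≟ₖ y) t∈F
  in progression-in-difference-set s∈ t∈ (trans key-s≡y (sym key-t≡y)) t∉exceptions
  where
  open TupleKeys p n m S
  _≟ₖ_ : DecidableEquality (Vec (Vec (Fin p) n) m)
  _≟ₖ_ = ≡-dec (≡-dec _≟_)
  _≟ₜ_ : DecidableEquality Tuple
  _≟ₜ_ = ≡-dec (≡-dec _≟_)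
  points : List (Vec (Fin p) n)
  points = tuples n (allFin p)
  key-listed : ∀ s → key s ∈ tuples m points
  key-listed s = ∈-tuples⁺ (λ _ → ∈-tuples⁺ (λ _ → ∈-allFin _))
  length-keys : length (tuples m points) ≡ (p ^ n) ^ m
  length-keys = trans (length-tuples m points)
                      (cong (_^ m) (trans (length-tuples n (allFin p)) (cong (_^ n) (length-tabulate (λ i → i)))))

corollaryE : (p : ℕ) (pp : Prime p) (k : ℕ) → 3 ≤ k → k ≤ p →
    (n : ℕ) (S : List (Vec (Fin p) n)) → Unique S →
    p ^ (k + (k ∸ 1) * n) ≤ length S ^ k →
    DiffSetHasAP p {{prime⇒nonZero pp}} k S
corollaryE p pp (suc (suc (suc m))) (s≤s (s≤s (s≤s z≤n))) k≤p n S unique-S large =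
  many-tuples⇒DiffSetHasAP p {{prime⇒nonZero pp}} n (suc m) S unique-S
                           (size-bound {N = length S} (suc m) n (s≤s z≤n) k≤p large)
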